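{- Let $G$ be a graph with a distinguished vertex $v$, let $k$ be an integer and $c\in[k]$, and assume $G$ has a proper $k$-colouring assigning $v$ the colour $c$. Let $M=x_1,x_2,\dots,x_l$ be a path in $G$ with $x_1=v$, and let $E$ be the event that $M$ is a path of disagreement (all $x_j$ are disagreeing). Then $\mathcal{L}_{G,k}[E]\leq\mathcal{P}_{G,k}[E]$.
   Context: $[k]=\{1,\dots,k\}$. The distribution $\mathcal{L}_{G,k}$ on labellings of vertices as "disagreeing"/"non-disagreeing" is induced by the experiment: choose $\sigma$ uniformly at random among the proper $k$-colourings of $G$ with $\sigma_v=c$; choose $q$ uniformly at random from $[k]\setminus\{c\}$; form the disagreement graph $Q_{c,q}$, the subgraph of $G$ induced by the vertices $x$ for which there is a path $v=w_0,\dots,w_t=x$ in $G$ with $\sigma_{w_j}\in\{c,q\}$ for all $j$; a vertex is disagreeing iff it belongs to $Q_{c,q}$. The product measure $\mathcal{P}_{G,k}$ makes each vertex $w\neq v$ disagreeing independently with probability $q_w=\frac{1}{k-\deg(w)}$ (with $q_w=1$ if $k\leq\deg(w)$), where $\deg(w)$ is the degree of $w$ in $G$, and makes $v$ disagreeing with probability $1$. -}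

module Defs where

open import Data.Bool using (Bool; true; false; _∧_; _∨_; not; if_then_else_)
open import Data.Nat using (ℕ; zero; suc; _∸_)
open import Data.Fin using (Fin; _≟_)
open import Data.List using (List; []; _∷_; length; filterᵇ; map; concatMap; allFin; foldr)
open import Data.Bool.ListAction using (any; all)
open import Data.Nat.ListAction using (sum)
open import Data.List.Relation.Unary.Unique.Propositional using (Unique)
open import Data.List.Membership.Propositional using (_∈_)
open import Data.Vec using (Vec; lookup) renaming ([] to []ᵥ; _∷_ to _∷ᵥ_)
open import Data.Integer using (+_)
open import Data.Rational using (ℚ; 0ℚ; 1ℚ; _*_; _/_)
open import Data.Product using (Σ; _×_)
open import Relation.Binary.PropositionalEquality using (_≡_; _≢_)
open import Relation.Nullary using (¬_)
open import Relation.Nullary.Decidable using (isYes; ⌊_⌋)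

record Graph (n : ℕ) : Set where
  field
    adj    : Fin n → Fin n → Bool
    sym    : ∀ u w → adj u w ≡ adj w u
    irrefl : ∀ u → adj u u ≡ false
open Graph public

_==_ : ∀ {m} → Fin m → Fin m → Bool
a == b = isYes (a ≟ b)

deg : ∀ {n} → Graph n → Fin n → ℕ
deg {n} G w = length (filterᵇ (adj G w) (allFin n))

Proper : ∀ {n k} → Graph n → (Fin n → Fin k) → Set
Proper G σ = ∀ u w → adj G u w ≡ true → σ u ≢ σ w

properB : ∀ {n k} → Graph n → (Fin n → Fin k) → Bool
properB {n} G σ = all (λ u → all (λ w → not (adj G u w) ∨ not (σ u == σ w)) (allFin n)) (allFin n)

allVecs : (n k : ℕ) → List (Vec (Fin k) n)
allVecs zero    k = []ᵥ ∷ []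
allVecs (suc n) k = concatMap (λ a → map (a ∷ᵥ_) (allVecs n k)) (allFin k)

inCQ : ∀ {k} → Fin k → Fin k → Fin k → Bool
inCQ c q a = (a == c) ∨ (a == q)

-- reachW G σ v c q t x : there is a walk v = w₀,…,w_s = x in G with s ≤ t
-- and σ w_j ∈ {c,q} for all j.
reachW : ∀ {n k} → Graph n → (Fin n → Fin k) → Fin n → Fin k → Fin k → ℕ → Fin n → Bool
reachW G σ v c q zero    x = (x == v) ∧ inCQ c q (σ v)
reachW {n} G σ v c q (suc t) x =
  reachW G σ v c q t x ∨
  (inCQ c q (σ x) ∧ any (λ y → adj G y x ∧ reachW G σ v c q t y) (allFin n))

-- x belongs to the disagreement graph Q_{c,q} (walks of length ≤ n suffice
-- since the graph has n vertices)
inQ : ∀ {n k} → Graph n → (Fin n → Fin k) → Fin n → Fin k → Fin k → Fin n → Bool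
inQ {n} G σ v c q x = reachW G σ v c q n x

count : ∀ {A : Set} → (A → Bool) → List A → ℕ
count p xs = length (filterᵇ p xs)

-- a / b as a rational, with convention a / 0 = 0
ratio : ℕ → ℕ → ℚ
ratio a zero    = 0ℚ
ratio a (suc b) = (+ a) / suc b

admissible : ∀ {n k} → Graph n → Fin n → Fin k → Vec (Fin k) n → Bool
admissible G v c s = properB G (lookup s) ∧ (lookup s v == c)

-- 𝓛_{G,k}[all vertices of M disagreeing]: (σ , q) uniform over admissible σ
-- and q ∈ [k] ∖ {c}.
LProb : ∀ {n} → Graph n → Fin n → (k : ℕ) → Fin k → List (Fin n) → ℚ
LProb {n} G v k c M =
  ratio (sum (map (λ s → count (λ q → not (q == c) ∧ all (inQ G (lookup s) v c q) M) (allFin k))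
               (filterᵇ (admissible G v c) (allVecs n k))))
        (count (admissible G v c) (allVecs n k) Data.Nat.* (k ∸ 1))
  where import Data.Nat

qw : ∀ {n} → Graph n → (k : ℕ) → Fin n → ℚ
qw G k w with k ∸ deg G w
... | zero  = 1ℚ
... | suc m = (+ 1) / suc m

-- probability that w is disagreeing under 𝓟_{G,k}
pDis : ∀ {n} → Graph n → Fin n → (k : ℕ) → Fin n → ℚ
pDis G v k w = if w == v then 1ℚ else qw G k w

-- 𝓟_{G,k}[all vertices of M disagreeing] = ∏_{w ∈ M} P[w disagreeing]
-- (product over the distinct vertices w that occur in M)
PProb : ∀ {n} → Graph n → Fin n → (k : ℕ) → List (Fin n) → ℚ
PProb {n} G v k M =
  foldr (λ w r → (if any (w ==_) M then pDis G v k w else 1ℚ) * r) 1ℚ (allFin n)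

data Consec {n} (G : Graph n) : List (Fin n) → Set where
  nil  : Consec G []
  one  : ∀ x → Consec G (x ∷ [])
  cons : ∀ x y xs → adj G x y ≡ true → Consec G (y ∷ xs) → Consec G (x ∷ y ∷ xs)

IsPath : ∀ {n} → Graph n → List (Fin n) → Set
IsPath G M = Consec G M × Unique M

module Submission where

-- Fix q ≠ c. If the path M = v, x₂, …, x_l lies in Q_{c,q} under a proper colouring σ with
-- σ v = c, then σ alternates c, q, c, … along M, so σ is pinned to a fixed colour on every x_j.
-- Pinning one vertex w ≠ v at a time loses a factor of at least k − deg w: every admissible
-- colouring with w pinned has at least k − deg w admissible recolourings at w, and the k
-- recolourings of each colouring double count all colourings. So at most a fraction
-- ∏_{j ≥ 2} q_{x_j} = 𝓟[E] of the admissible colourings make M disagreeing for this q, and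
-- averaging over the k − 1 choices of q gives 𝓛[E] ≤ 𝓟[E].

open import Defs hiding (sym)
open import Data.Bool using (Bool; true; false; T; _∧_; _∨_; not; if_then_else_)
open import Data.Bool.Properties using (T-∧; T-∨; T-≡; ∧-identityʳ)
open import Data.Bool.ListAction using (any; all)
open import Data.Empty using (⊥-elim)
open import Data.Fin using (Fin; zero; suc; _≟_)
open import Data.Fin.Properties using (nonZeroIndex)
open import Data.Integer.Properties using (pos-*)
import Data.Integer as ℤ
open import Data.List using (List; []; _∷_; length; filterᵇ; map; concatMap; allFin; foldr; _++_)
open import Data.List.Properties using (length-tabulate; map-tabulate)
open import Data.List.Membership.Propositional.Properties using (∈-allFin)
open import Data.List.Relation.Unary.All using (All; []; _∷_)
import Data.List.Relation.Unary.All as All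
open import Data.List.Relation.Unary.All.Properties using (all⁺; all⁻)
open import Data.List.Relation.Unary.AllPairs using ([]; _∷_)
open import Data.List.Relation.Unary.Unique.Propositional using (Unique)
open import Data.List.Relation.Unary.Unique.Propositional.Properties using (allFin⁺)
open import Data.Nat using (ℕ; zero; suc; _+_; _*_; _∸_; _⊔_; _≤_; z≤n)
open import Data.Nat.Properties hiding (_≟_)
open import Data.Nat.ListAction using (sum; product)
open import Data.Nat.Tactic.RingSolver using (solve-∀)
open import Data.Product using (Σ; _×_; _,_; proj₁; proj₂)
open import Data.Rational using (ℚ; 1ℚ; toℚᵘ)
import Data.Rational as ℚ
open import Data.Rational.Properties using (toℚᵘ-homo-*; toℚᵘ-cancel-≤; toℚᵘ-fromℚᵘ)
open import Data.Rational.Unnormalised using (ℚᵘ; mkℚᵘ; *≤*; *≡*)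
import Data.Rational.Unnormalised as ℚᵘ
import Data.Rational.Unnormalised.Properties as ℚᵘ
open import Data.Sum using (_⊎_; inj₁; inj₂)
import Data.Sum as Sum
open import Data.Vec using (Vec; lookup; _[_]≔_) renaming (_∷_ to _∷ᵥ_)
open import Data.Vec.Properties using (lookup∘update; lookup∘update′; []≔-idempotent)
open import Function using (_∘_; id)
open import Function.Bundles using (Equivalence)
open import Relation.Binary.PropositionalEquality
open import Relation.Nullary using (yes; no)
open import Relation.Nullary.Decidable using (isYes≗does; toWitness; fromWitness; toWitnessFalse; fromWitnessFalse)

variable
  A B : Set

∑ : List A → (A → ℕ) → ℕ
∑ []       f = 0
∑ (x ∷ xs) f = f x + ∑ xs f

syntax ∑ xs (λ x → e) = ∑[ x ∈ xs ] e

∑-cong : ∀ xs {f g : A → ℕ} → (∀ x → f x ≡ g x) → ∑ xs f ≡ ∑ xs g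
∑-cong []       f≗g = refl
∑-cong (x ∷ xs) f≗g = cong₂ _+_ (f≗g x) (∑-cong xs f≗g)

∑-mono : ∀ xs {f g : A → ℕ} → (∀ x → f x ≤ g x) → ∑ xs f ≤ ∑ xs g
∑-mono []       f≤g = z≤n
∑-mono (x ∷ xs) f≤g = +-mono-≤ (f≤g x) (∑-mono xs f≤g)

∑-const : ∀ (xs : List A) m → ∑[ _ ∈ xs ] m ≡ length xs * m
∑-const []       m = refl
∑-const (x ∷ xs) m = cong (m +_) (∑-const xs m)

∑-zero : ∀ (xs : List A) → ∑[ _ ∈ xs ] 0 ≡ 0
∑-zero []       = refl
∑-zero (x ∷ xs) = ∑-zero xs

∑-distrib-+ : ∀ xs (f g : A → ℕ) → ∑[ x ∈ xs ] (f x + g x) ≡ ∑ xs f + ∑ xs g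
∑-distrib-+ []       f g = refl
∑-distrib-+ (x ∷ xs) f g = trans (cong (f x + g x +_) (∑-distrib-+ xs f g)) (interchange (f x) (g x) _ _)
  where
  interchange : ∀ a b c d → (a + b) + (c + d) ≡ (a + c) + (b + d)
  interchange = solve-∀

∑-*ˡ : ∀ m xs (f : A → ℕ) → ∑[ x ∈ xs ] (m * f x) ≡ m * ∑ xs f
∑-*ˡ m []       f = sym (*-zeroʳ m)
∑-*ˡ m (x ∷ xs) f = trans (cong (m * f x +_) (∑-*ˡ m xs f)) (sym (*-distribˡ-+ m (f x) (∑ xs f)))

∑-*ʳ : ∀ m xs (f : A → ℕ) → ∑[ x ∈ xs ] (f x * m) ≡ ∑ xs f * m
∑-*ʳ m []       f = refl
∑-*ʳ m (x ∷ xs) f = trans (cong (f x * m +_) (∑-*ʳ m xs f)) (sym (*-distribʳ-+ m (f x) (∑ xs f)))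

∑-comm : ∀ (xs : List A) (ys : List B) (h : A → B → ℕ) →
         ∑[ x ∈ xs ] ∑[ y ∈ ys ] h x y ≡ ∑[ y ∈ ys ] ∑[ x ∈ xs ] h x y
∑-comm []       ys h = sym (∑-zero ys)
∑-comm (x ∷ xs) ys h =
  trans (cong (∑ ys (h x) +_) (∑-comm xs ys h)) (sym (∑-distrib-+ ys (h x) λ y → ∑[ x ∈ xs ] h x y))

∑-map : ∀ (g : A → B) xs f → ∑ (map g xs) f ≡ ∑[ x ∈ xs ] f (g x)
∑-map g []       f = refl
∑-map g (x ∷ xs) f = cong (f (g x) +_) (∑-map g xs f)

∑-concatMap : ∀ (g : A → List B) xs f → ∑ (concatMap g xs) f ≡ ∑[ x ∈ xs ] ∑ (g x) f
∑-concatMap g []       f = refl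
∑-concatMap g (x ∷ xs) f =
  trans (∑-++ (g x) _) (cong (∑ (g x) f +_) (∑-concatMap g xs f))
  where
  ∑-++ : ∀ ys zs → ∑ (ys ++ zs) f ≡ ∑ ys f + ∑ zs f
  ∑-++ []       zs = refl
  ∑-++ (y ∷ ys) zs = trans (cong (f y +_) (∑-++ ys zs)) (sym (+-assoc (f y) _ _))

sum-map : ∀ (f : A → ℕ) xs → sum (map f xs) ≡ ∑ xs f
sum-map f []       = refl
sum-map f (x ∷ xs) = cong (f x +_) (sum-map f xs)

∑-filterᵇ : ∀ (p : A → Bool) xs f → ∑ (filterᵇ p xs) f ≡ ∑[ x ∈ xs ] (if p x then f x else 0)
∑-filterᵇ p []       f = refl
∑-filterᵇ p (x ∷ xs) f with p x
... | true  = cong (f x +_) (∑-filterᵇ p xs f)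
... | false = ∑-filterᵇ p xs f

𝟙 : Bool → ℕ
𝟙 true  = 1
𝟙 false = 0

𝟙-mono : ∀ {a b} → (T a → T b) → 𝟙 a ≤ 𝟙 b
𝟙-mono {false}         _   = z≤n
𝟙-mono {true}  {true}  _   = ≤-refl
𝟙-mono {true}  {false} a⇒b = ⊥-elim (a⇒b _)

count-∑ : ∀ (p : A → Bool) xs → count p xs ≡ ∑[ x ∈ xs ] 𝟙 (p x)
count-∑ p []       = refl
count-∑ p (x ∷ xs) with p x
... | true  = cong suc (count-∑ p xs)
... | false = count-∑ p xs

count-mono : ∀ {p q : A → Bool} xs → (∀ x → T (p x) → T (q x)) → count p xs ≤ count q xs
count-mono {p = p} {q} xs p⇒q =
  subst₂ _≤_ (sym (count-∑ p xs)) (sym (count-∑ q xs)) (∑-mono xs λ x → 𝟙-mono (p⇒q x))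

count-cong : ∀ {p q : A → Bool} xs → (∀ x → p x ≡ q x) → count p xs ≡ count q xs
count-cong {p = p} {q} xs p≗q =
  trans (count-∑ p xs) (trans (∑-cong xs (cong 𝟙 ∘ p≗q)) (sym (count-∑ q xs)))

count-false : ∀ (xs : List A) → count (λ _ → false) xs ≡ 0
count-false []       = refl
count-false (x ∷ xs) = count-false xs

count-true : ∀ (xs : List A) → count (λ _ → true) xs ≡ length xs
count-true []       = refl
count-true (x ∷ xs) = cong suc (count-true xs)

∧⁻ : ∀ {a b} → T (a ∧ b) → T a × T b
∧⁻ = Equivalence.to T-∧

∧⁺ : ∀ {a b} → T a → T b → T (a ∧ b)
∧⁺ p q = Equivalence.from T-∧ (p , q)

⇒⁻ : ∀ {a b} → T (not a ∨ b) → a ≡ true → T b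
⇒⁻ {true} b refl = b

⇒⁺ : ∀ {a b} → (a ≡ true → T b) → T (not a ∨ b)
⇒⁺ {false} _   = _
⇒⁺ {true}  a⇒b = a⇒b refl

suc-== : ∀ {n} (a b : Fin n) → (suc a == suc b) ≡ (a == b)
suc-== a b = trans (isYes≗does (suc a ≟ suc b)) (sym (isYes≗does (a ≟ b)))

∑-allFin-suc : ∀ n (h : Fin (suc n) → ℕ) →
               ∑ (allFin (suc n)) h ≡ h zero + ∑[ b ∈ allFin n ] h (suc b)
∑-allFin-suc n h =
  cong (h zero +_) (trans (cong (λ bs → ∑ bs h) (sym (map-tabulate id suc))) (∑-map suc (allFin n) h))

∑-allFin-pick : ∀ {n} (a : Fin n) (h : Fin n → ℕ) →
                ∑[ b ∈ allFin n ] (if b == a then h b else 0) ≡ h a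
∑-allFin-pick {suc n} zero h =
  trans (∑-allFin-suc n _) (trans (cong (h zero +_) (∑-zero (allFin n))) (+-identityʳ (h zero)))
∑-allFin-pick {suc n} (suc a) h = begin
  ∑[ b ∈ allFin (suc n) ] (if b == suc a then h b else 0)
    ≡⟨ ∑-allFin-suc n (λ b → if b == suc a then h b else 0) ⟩
  ∑[ b ∈ allFin n ] (if suc b == suc a then h (suc b) else 0)
    ≡⟨ ∑-cong (allFin n) (λ b → cong (λ t → if t then h (suc b) else 0) (suc-== b a)) ⟩
  ∑[ b ∈ allFin n ] (if b == a then h (suc b) else 0)       ≡⟨ ∑-allFin-pick a (h ∘ suc) ⟩
  h (suc a)                                                 ∎
  where open ≡-Reasoning

count-allFin-except : ∀ {k} (c : Fin k) (Q : Fin k → Bool) →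
  count Q (allFin k) ≡ count (λ b → not (b == c) ∧ Q b) (allFin k) + 𝟙 (Q c)
count-allFin-except {k} c Q = begin
  count Q (allFin k)                                            ≡⟨ count-∑ Q (allFin k) ⟩
  ∑[ b ∈ allFin k ] 𝟙 (Q b)                                     ≡⟨ ∑-cong (allFin k) split ⟩
  ∑[ b ∈ allFin k ] (𝟙 (not (b == c) ∧ Q b) + (if b == c then 𝟙 (Q b) else 0))
    ≡⟨ ∑-distrib-+ (allFin k) _ _ ⟩
  ∑[ b ∈ allFin k ] 𝟙 (not (b == c) ∧ Q b) + ∑[ b ∈ allFin k ] (if b == c then 𝟙 (Q b) else 0)
    ≡⟨ cong₂ _+_ (sym (count-∑ _ (allFin k))) (∑-allFin-pick c (𝟙 ∘ Q)) ⟩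
  count (λ b → not (b == c) ∧ Q b) (allFin k) + 𝟙 (Q c)         ∎
  where
  open ≡-Reasoning
  split : ∀ b → 𝟙 (Q b) ≡ 𝟙 (not (b == c) ∧ Q b) + (if b == c then 𝟙 (Q b) else 0)
  split b with b == c
  ... | true  = refl
  ... | false = sym (+-identityʳ _)

count-allFin-≢ : ∀ {k} (c : Fin k) → count (λ b → not (b == c)) (allFin k) ≡ k ∸ 1
count-allFin-≢ {k} c = begin
  count (λ b → not (b == c)) (allFin k)                  ≡⟨ sym (m+n∸n≡m _ 1) ⟩
  count (λ b → not (b == c)) (allFin k) + 1 ∸ 1
    ≡⟨ cong (λ m → m + 1 ∸ 1) (count-cong (allFin k) λ b → sym (∧-identityʳ (not (b == c)))) ⟩
  count (λ b → not (b == c) ∧ true) (allFin k) + 1 ∸ 1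
    ≡⟨ cong (_∸ 1) (sym (count-allFin-except c _)) ⟩
  count (λ _ → true) (allFin k) ∸ 1                      ≡⟨ cong (_∸ 1) (count-true (allFin k)) ⟩
  length (allFin k) ∸ 1                                  ≡⟨ cong (_∸ 1) (length-tabulate {n = k} id) ⟩
  k ∸ 1                                                  ∎
  where open ≡-Reasoning

-- Each of the (count p ys) constraints "b ≠ g y" rules out at most one colour b.
count-avoiding : ∀ {n} k (g : Fin n → Fin k) (p : Fin n → Bool) ys →
  k ∸ count p ys ≤ count (λ b → all (λ y → not (p y) ∨ not (b == g y)) ys) (allFin k)
count-avoiding k g p [] = ≤-reflexive (trans (sym (length-tabulate id)) (sym (count-true (allFin k))))
count-avoiding k g p (y ∷ ys) with p y
... | false = count-avoiding k g p ys
... | true  = m≤n+o⇒m∸n≤o k (suc m) (begin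
  k                           ≤⟨ m≤n+m∸n k m ⟩
  m + (k ∸ m)                 ≤⟨ +-monoʳ-≤ m (count-avoiding k g p ys) ⟩
  m + count Q (allFin k)      ≡⟨ cong (m +_) (count-allFin-except (g y) Q) ⟩
  m + (X + 𝟙 (Q (g y)))       ≤⟨ +-monoʳ-≤ m (+-monoʳ-≤ X (𝟙-≤-1 (Q (g y)))) ⟩
  m + (X + 1)                 ≡⟨ cong (m +_) (+-comm X 1) ⟩
  m + suc X                   ≡⟨ +-suc m X ⟩
  suc m + X                   ∎)
  where
  open ≤-Reasoning
  m = count p ys
  Q = λ b → all (λ y → not (p y) ∨ not (b == g y)) ys
  X = count (λ b → not (b == g y) ∧ Q b) (allFin k)
  𝟙-≤-1 : ∀ a → 𝟙 a ≤ 1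
  𝟙-≤-1 true  = ≤-refl
  𝟙-≤-1 false = z≤n

module _ {n k : ℕ} (G : Graph n) where

  edgeOK : (Fin n → Fin k) → Fin n → Fin n → Bool
  edgeOK σ u w = not (adj G u w) ∨ not (σ u == σ w)

  properB⇒Proper : (σ : Fin n → Fin k) → T (properB G σ) → Proper G σ
  properB⇒Proper σ proper u w uw =
    toWitnessFalse (⇒⁻ (All.lookup (all⁺ (edgeOK σ u) (allFin n) properAt-u) (∈-allFin w)) uw)
    where
    properAt-u = All.lookup (all⁺ (λ u → all (edgeOK σ u) (allFin n)) (allFin n) proper) (∈-allFin u)

  Proper⇒properB : (σ : Fin n → Fin k) → Proper G σ → T (properB G σ)
  Proper⇒properB σ proper =
    all⁻ (λ u → all (edgeOK σ u) (allFin n)) {allFin n} (All.tabulate λ {u} _ →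
      all⁻ (edgeOK σ u) {allFin n} (All.tabulate λ {w} _ → ⇒⁺ λ uw → fromWitnessFalse (proper u w uw)))

  avoids : Fin n → (Fin n → Fin k) → Fin k → Bool
  avoids x σ b = all (λ y → not (adj G x y) ∨ not (b == σ y)) (allFin n)

  avoids⇒≢ : ∀ {x σ b} → T (avoids x σ b) → ∀ y → adj G x y ≡ true → b ≢ σ y
  avoids⇒≢ {x} {σ} {b} avoid y xy = toWitnessFalse (⇒⁻ (All.lookup avoid-all (∈-allFin y)) xy)
    where
    avoid-all = all⁺ (λ y → not (adj G x y) ∨ not (b == σ y)) (allFin n) avoid

  recolour-Proper : ∀ (s : Vec (Fin k) n) x b → Proper G (lookup s) → T (avoids x (lookup s) b) →
                    Proper G (lookup (s [ x ]≔ b))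
  recolour-Proper s x b proper avoid u w uw su≡sw with u ≟ x | w ≟ x
  ... | yes refl | yes refl with () ← trans (sym uw) (irrefl G u)
  ... | yes refl | no w≢x =
    avoids⇒≢ avoid w uw (trans (sym (lookup∘update u s b)) (trans su≡sw (lookup∘update′ w≢x s b)))
  ... | no u≢x | yes refl =
    avoids⇒≢ avoid u (trans (Graph.sym G w u) uw)
      (trans (sym (lookup∘update w s b)) (trans (sym su≡sw) (lookup∘update′ u≢x s b)))
  ... | no u≢x | no w≢x =
    proper u w uw (trans (sym (lookup∘update′ u≢x s b)) (trans su≡sw (lookup∘update′ w≢x s b)))

  recolour-admissible : ∀ {v c} (s : Vec (Fin k) n) x b → x ≢ v → T (admissible G v c s) →
                        T (avoids x (lookup s) b) → T (admissible G v c (s [ x ]≔ b))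
  recolour-admissible {v} {c} s x b x≢v adm avoid =
    ∧⁺ (Proper⇒properB _ (recolour-Proper s x b (properB⇒Proper _ proper) avoid))
       (subst (λ a → T (a == c)) (sym (lookup∘update′ (x≢v ∘ sym) s b)) sv≡c)
    where
    proper = proj₁ (∧⁻ adm)
    sv≡c = proj₂ (∧⁻ {properB G (lookup s)} adm)

∑-allVecs-suc : ∀ n k (F : Vec (Fin k) (suc n) → ℕ) →
                ∑ (allVecs (suc n) k) F ≡ ∑[ a ∈ allFin k ] ∑[ t ∈ allVecs n k ] F (a ∷ᵥ t)
∑-allVecs-suc n k F = trans (∑-concatMap (λ a → map (a ∷ᵥ_) (allVecs n k)) (allFin k) F)
                            (∑-cong (allFin k) λ a → ∑-map (a ∷ᵥ_) (allVecs n k) F)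

∑-allVecs-recolour : ∀ n k (x : Fin n) (F : Vec (Fin k) n → ℕ) →
  ∑[ s ∈ allVecs n k ] ∑[ b ∈ allFin k ] F (s [ x ]≔ b) ≡ k * ∑ (allVecs n k) F
∑-allVecs-recolour (suc n) k zero F = begin
  ∑[ s ∈ allVecs (suc n) k ] ∑[ b ∈ allFin k ] F (s [ zero ]≔ b)   ≡⟨ ∑-allVecs-suc n k _ ⟩
  ∑[ a ∈ allFin k ] ∑[ t ∈ allVecs n k ] ∑[ b ∈ allFin k ] F (b ∷ᵥ t)
    ≡⟨ ∑-cong (allFin k) (λ _ → ∑-comm (allVecs n k) (allFin k) λ t b → F (b ∷ᵥ t)) ⟩
  ∑[ a ∈ allFin k ] ∑[ b ∈ allFin k ] ∑[ t ∈ allVecs n k ] F (b ∷ᵥ t)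
    ≡⟨ ∑-cong (allFin k) (λ _ → sym (∑-allVecs-suc n k F)) ⟩
  ∑[ a ∈ allFin k ] ∑ (allVecs (suc n) k) F                         ≡⟨ ∑-const (allFin k) _ ⟩
  length (allFin k) * ∑ (allVecs (suc n) k) F
    ≡⟨ cong (_* ∑ (allVecs (suc n) k) F) (length-tabulate {n = k} id) ⟩
  k * ∑ (allVecs (suc n) k) F                                       ∎
  where open ≡-Reasoning
∑-allVecs-recolour (suc n) k (suc x) F = begin
  ∑[ s ∈ allVecs (suc n) k ] ∑[ b ∈ allFin k ] F (s [ suc x ]≔ b)   ≡⟨ ∑-allVecs-suc n k _ ⟩
  ∑[ a ∈ allFin k ] ∑[ t ∈ allVecs n k ] ∑[ b ∈ allFin k ] F (a ∷ᵥ (t [ x ]≔ b))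
    ≡⟨ ∑-cong (allFin k) (λ a → ∑-allVecs-recolour n k x (F ∘ (a ∷ᵥ_))) ⟩
  ∑[ a ∈ allFin k ] (k * ∑[ t ∈ allVecs n k ] F (a ∷ᵥ t))           ≡⟨ ∑-*ˡ k (allFin k) _ ⟩
  k * ∑[ a ∈ allFin k ] ∑[ t ∈ allVecs n k ] F (a ∷ᵥ t)
    ≡⟨ cong (k *_) (sym (∑-allVecs-suc n k F)) ⟩
  k * ∑ (allVecs (suc n) k) F                                       ∎
  where open ≡-Reasoning

*-𝟙-≤ : ∀ m b {X} → (T b → m ≤ X) → m * 𝟙 b ≤ X
*-𝟙-≤ m false _   = ≤-trans (≤-reflexive (*-zeroʳ m)) z≤n
*-𝟙-≤ m true  m≤X = ≤-trans (≤-reflexive (*-identityʳ m)) (m≤X _)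

⊔-1-*-≤ : ∀ m {X Y} → X ≤ Y → m * X ≤ Y → (1 ⊔ m) * X ≤ Y
⊔-1-*-≤ zero    X≤Y _    = ≤-trans (≤-reflexive (*-identityˡ _)) X≤Y
⊔-1-*-≤ (suc m) _   mX≤Y = mX≤Y

-- For a pinned vertex, weight w is 1/q_w.
weight : ∀ {n} → Graph n → ℕ → (Fin n → Bool) → Fin n → ℕ
weight G k pinned w = if pinned w then 1 ⊔ (k ∸ deg G w) else 1

agrees : ∀ {n k} → (Fin n → Bool) → (Fin n → Fin k) → List (Fin n) → Vec (Fin k) n → Bool
agrees pinned t ℓ s = all (λ w → not (pinned w) ∨ (lookup s w == t w)) ℓ

agrees-recolour : ∀ {n k} (pinned : Fin n → Bool) (t : Fin n → Fin k) ℓ {w} → All (w ≢_) ℓ →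
                  ∀ s a → agrees pinned t ℓ (s [ w ]≔ a) ≡ agrees pinned t ℓ s
agrees-recolour pinned t []      []            s a = refl
agrees-recolour pinned t (y ∷ ℓ) (w≢y ∷ w∉ℓ) s a =
  cong₂ _∧_ (cong (λ b → not (pinned y) ∨ (b == t y)) (lookup∘update′ (w≢y ∘ sym) s a))
            (agrees-recolour pinned t ℓ w∉ℓ s a)

module _ {n k : ℕ} (G : Graph n) (v : Fin n) (c : Fin k) where

  private
    Colourings = allVecs n k
    adm = admissible G v c

  -- Double counting: every admissible colouring with x coloured a can be recoloured at x in at
  -- least k ∸ deg x ways, and each recolouring is again admissible.
  recolouring-bound : ∀ x → x ≢ v → (R : Vec (Fin k) n → Bool) →
    (∀ s a b → R (s [ x ]≔ a) ≡ R (s [ x ]≔ b)) → ∀ a →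
    (k ∸ deg G x) * count (λ s → (lookup s x == a ∧ R s) ∧ adm s) Colourings
      ≤ count (λ s → R s ∧ adm s) Colourings
  recolouring-bound x x≢v R R-ignores-x a =
    subst₂ (λ P Q → (k ∸ deg G x) * P ≤ Q) (sym (count-∑ _ Colourings)) (sym (count-∑ _ Colourings))
      (*-cancelˡ-≤ k {{nonZeroIndex c}} (begin
        k * ((k ∸ deg G x) * ∑ Colourings coloured-a)
          ≡⟨ x*[y*z]≡y*[x*z] k (k ∸ deg G x) _ ⟩
        (k ∸ deg G x) * (k * ∑ Colourings coloured-a)
          ≡⟨ cong ((k ∸ deg G x) *_) (sym (∑-allVecs-recolour n k x coloured-a)) ⟩
        (k ∸ deg G x) * ∑[ s ∈ Colourings ] ∑[ b ∈ allFin k ] coloured-a (s [ x ]≔ b)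
          ≡⟨ sym (∑-*ˡ (k ∸ deg G x) Colourings _) ⟩
        ∑[ s ∈ Colourings ] ((k ∸ deg G x) * ∑[ b ∈ allFin k ] coloured-a (s [ x ]≔ b))
          ≤⟨ ∑-mono Colourings per-colouring ⟩
        ∑[ s ∈ Colourings ] ∑[ b ∈ allFin k ] good (s [ x ]≔ b)
          ≡⟨ ∑-allVecs-recolour n k x good ⟩
        k * ∑ Colourings good ∎))
    where
    open ≤-Reasoning
    good coloured-a : Vec (Fin k) n → ℕ
    good s = 𝟙 (R s ∧ adm s)
    coloured-a s = 𝟙 ((lookup s x == a ∧ R s) ∧ adm s)

    x*[y*z]≡y*[x*z] : ∀ x y z → x * (y * z) ≡ y * (x * z)
    x*[y*z]≡y*[x*z] = solve-∀

    pick-a : ∀ s → ∑[ b ∈ allFin k ] coloured-a (s [ x ]≔ b) ≡ good (s [ x ]≔ a)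
    pick-a s = trans (∑-cong (allFin k) λ b → trans (colour-at-x b) (𝟙-pin (b == a) _ _))
                     (∑-allFin-pick a λ b → good (s [ x ]≔ b))
      where
      colour-at-x : ∀ b → coloured-a (s [ x ]≔ b) ≡ 𝟙 ((b == a ∧ R (s [ x ]≔ b)) ∧ adm (s [ x ]≔ b))
      colour-at-x b =
        cong (λ a′ → 𝟙 ((a′ == a ∧ R (s [ x ]≔ b)) ∧ adm (s [ x ]≔ b))) (lookup∘update x s b)

      𝟙-pin : ∀ p q r → 𝟙 ((p ∧ q) ∧ r) ≡ (if p then 𝟙 (q ∧ r) else 0)
      𝟙-pin true  q r = refl
      𝟙-pin false q r = refl

    recoloured-good : ∀ s b → T (R (s [ x ]≔ a) ∧ adm (s [ x ]≔ a)) →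
                      T (avoids G x (lookup (s [ x ]≔ a)) b) → T (R (s [ x ]≔ b) ∧ adm (s [ x ]≔ b))
    recoloured-good s b good-a avoid =
      ∧⁺ (subst T (R-ignores-x s a b) (proj₁ (∧⁻ good-a)))
         (subst (T ∘ adm) ([]≔-idempotent s x)
           (recolour-admissible G (s [ x ]≔ a) x b x≢v (proj₂ (∧⁻ {R (s [ x ]≔ a)} good-a)) avoid))

    per-colouring : ∀ s → (k ∸ deg G x) * ∑[ b ∈ allFin k ] coloured-a (s [ x ]≔ b)
                          ≤ ∑[ b ∈ allFin k ] good (s [ x ]≔ b)
    per-colouring s rewrite pick-a s = *-𝟙-≤ (k ∸ deg G x) _ λ good-a → begin
      k ∸ deg G x
        ≤⟨ count-avoiding k _ (adj G x) (allFin n) ⟩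
      count (avoids G x (lookup (s [ x ]≔ a))) (allFin k)
        ≤⟨ count-mono (allFin k) (λ b → recoloured-good s b good-a) ⟩
      count (λ b → R (s [ x ]≔ b) ∧ adm (s [ x ]≔ b)) (allFin k)      ≡⟨ count-∑ _ (allFin k) ⟩
      ∑[ b ∈ allFin k ] good (s [ x ]≔ b)                            ∎

  pinned-bound : (pinned : Fin n → Bool) → (∀ w → T (pinned w) → w ≢ v) → (t : Fin n → Fin k) →
    ∀ ℓ → Unique ℓ →
    count (λ s → agrees pinned t ℓ s ∧ adm s) Colourings * product (map (weight G k pinned) ℓ)
      ≤ count adm Colourings
  pinned-bound pinned pinned⇒≢v t []      []             = ≤-reflexive (*-identityʳ _)
  pinned-bound pinned pinned⇒≢v t (w ∷ ℓ) (w∉ℓ ∷ unique) with pinned w in pinned-w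
  ... | false =
    ≤-trans (≤-reflexive (cong (Y *_) (*-identityˡ P))) (pinned-bound pinned pinned⇒≢v t ℓ unique)
    where
    Y = count (λ s → agrees pinned t ℓ s ∧ adm s) Colourings
    P = product (map (weight G k pinned) ℓ)
  ... | true = begin
    X * ((1 ⊔ (k ∸ deg G w)) * P)   ≡⟨ x*[y*z]≡[y*x]*z X (1 ⊔ (k ∸ deg G w)) P ⟩
    (1 ⊔ (k ∸ deg G w)) * X * P     ≤⟨ *-monoˡ-≤ P (⊔-1-*-≤ (k ∸ deg G w) X≤Y recoloured) ⟩
    Y * P                           ≤⟨ pinned-bound pinned pinned⇒≢v t ℓ unique ⟩
    count adm Colourings            ∎
    where
    open ≤-Reasoning
    X = count (λ s → (lookup s w == t w ∧ agrees pinned t ℓ s) ∧ adm s) Colourings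
    Y = count (λ s → agrees pinned t ℓ s ∧ adm s) Colourings
    P = product (map (weight G k pinned) ℓ)

    x*[y*z]≡[y*x]*z : ∀ x y z → x * (y * z) ≡ y * x * z
    x*[y*z]≡[y*x]*z = solve-∀

    X≤Y : X ≤ Y
    X≤Y = count-mono Colourings λ s pinned-agrees →
      let agree , adm-s = ∧⁻ pinned-agrees in ∧⁺ (proj₂ (∧⁻ {lookup s w == t w} agree)) adm-s

    recoloured : (k ∸ deg G w) * X ≤ Y
    recoloured = recolouring-bound w (pinned⇒≢v w (subst T (sym pinned-w) _)) (agrees pinned t ℓ)
      (λ s a b → trans (agrees-recolour pinned t ℓ w∉ℓ s a) (sym (agrees-recolour pinned t ℓ w∉ℓ s b)))
      (t w)

alternate : ∀ {n k} → List (Fin n) → Fin k → Fin k → Fin n → Fin k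
alternate []       a b w = a
alternate (y ∷ ys) a b w = if w == y then a else alternate ys b a w

module _ {n k : ℕ} (G : Graph n) where

  path-alternates : (σ : Fin n → Fin k) → Proper G σ → ∀ {y ys} → Consec G (y ∷ ys) →
    ∀ {a b} → σ y ≡ a → All (λ z → σ z ≡ a ⊎ σ z ≡ b) ys →
    ∀ w → T (any (w ==_) (y ∷ ys)) → σ w ≡ alternate (y ∷ ys) a b w
  path-alternates σ proper {y} path σy≡a σys w w∈path with w ≟ y
  ... | yes refl = σy≡a
  path-alternates σ proper (one y)                   σy≡a []            w () | no _
  path-alternates σ proper (cons y z zs yz path) {a} {b} σy≡a (σz ∷ σzs) w w∈path | no _ =
    path-alternates σ proper path (σz≡b σz) (All.map Sum.swap σzs) w w∈path
    where
    σz≡b : σ z ≡ a ⊎ σ z ≡ b → σ z ≡ b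
    σz≡b (inj₁ σz≡a) = ⊥-elim (proper y z yz (trans σy≡a (sym σz≡a)))
    σz≡b (inj₂ σz≡b) = σz≡b

  inCQ⇒ : ∀ {c q a : Fin k} → T (inCQ c q a) → a ≡ c ⊎ a ≡ q
  inCQ⇒ {c} {q} {a} a∈cq = Sum.map toWitness toWitness (Equivalence.to (T-∨ {a == c} {a == q}) a∈cq)

  reachW-two-coloured : (σ : Fin n → Fin k) → ∀ v c q t x →
                        T (reachW G σ v c q t x) → σ x ≡ c ⊎ σ x ≡ q
  reachW-two-coloured σ v c q zero x reached =
    subst (λ z → σ z ≡ c ⊎ σ z ≡ q) (sym (toWitness x≡v)) (inCQ⇒ cq)
    where
    x≡v = proj₁ (∧⁻ {x == v} reached)
    cq = proj₂ (∧⁻ {x == v} reached)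
  reachW-two-coloured σ v c q (suc t) x reached with Equivalence.to (T-∨ {reachW G σ v c q t x}) reached
  ... | inj₁ earlier = reachW-two-coloured σ v c q t x earlier
  ... | inj₂ step    = inCQ⇒ (proj₁ (∧⁻ step))

1≤weight : ∀ {n} (G : Graph n) k pinned w → 1 ≤ weight G k pinned w
1≤weight G k pinned w with pinned w
... | true  = m≤m⊔n 1 (k ∸ deg G w)
... | false = ≤-refl

1≤product : (g : A → ℕ) → (∀ x → 1 ≤ g x) → ∀ xs → 1 ≤ product (map g xs)
1≤product g 1≤g []       = ≤-refl
1≤product g 1≤g (x ∷ xs) = *-mono-≤ (1≤g x) (1≤product g 1≤g xs)

-- 1/m for m ≥ 1, since mkℚᵘ p d stands for p / (1 + d).
recip : ℕ → ℚᵘ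
recip m = mkℚᵘ (ℤ.+ 1) (m ∸ 1)

recip-* : ∀ {a b} → 1 ≤ a → 1 ≤ b → recip a ℚᵘ.* recip b ℚᵘ.≃ recip (a * b)
recip-* {suc a} {suc b} _ _ = *≡* refl

toℚᵘ-/ : ∀ a m → toℚᵘ ((ℤ.+ a) ℚ./ suc m) ℚᵘ.≃ mkℚᵘ (ℤ.+ a) m
toℚᵘ-/ a m = toℚᵘ-fromℚᵘ (mkℚᵘ (ℤ.+ a) m)

toℚᵘ-product : (f : A → ℚ) (g : A → ℕ) → (∀ x → 1 ≤ g x) →
               (∀ x → toℚᵘ (f x) ℚᵘ.≃ recip (g x)) →
               ∀ xs → toℚᵘ (foldr (λ x r → f x ℚ.* r) 1ℚ xs) ℚᵘ.≃ recip (product (map g xs))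
toℚᵘ-product f g 1≤g f≃1/g []       = *≡* refl
toℚᵘ-product f g 1≤g f≃1/g (x ∷ xs) = ℚᵘ.≃-trans (toℚᵘ-homo-* (f x) _)
  (ℚᵘ.≃-trans (ℚᵘ.*-cong (f≃1/g x) (toℚᵘ-product f g 1≤g f≃1/g xs))
              (recip-* (1≤g x) (1≤product g 1≤g xs)))

mkℚᵘ-mono : ∀ a b c d → a * suc d ≤ b * suc c → mkℚᵘ (ℤ.+ a) c ℚᵘ.≤ mkℚᵘ (ℤ.+ b) d
mkℚᵘ-mono a b c d ad≤bc = *≤* (subst₂ ℤ._≤_ (pos-* a (suc d)) (pos-* b (suc c)) (ℤ.+≤+ ad≤bc))

ratio-≤-recip : ∀ N D E (p : ℚ) → 1 ≤ E → N * E ≤ D → toℚᵘ p ℚᵘ.≃ recip E →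
                ratio N D ℚ.≤ p
ratio-≤-recip N zero    (suc E) p _ _     p≃1/E = toℚᵘ-cancel-≤
  (ℚᵘ.≤-respʳ-≃ (ℚᵘ.≃-sym p≃1/E)
    (ℚᵘ.≤-respˡ-≃ (ℚᵘ.≃-sym (toℚᵘ-/ 0 0)) (mkℚᵘ-mono 0 1 0 E z≤n)))
ratio-≤-recip N (suc D) (suc E) p _ NE≤D p≃1/E = toℚᵘ-cancel-≤
  (ℚᵘ.≤-respʳ-≃ (ℚᵘ.≃-sym p≃1/E) (ℚᵘ.≤-respˡ-≃ (ℚᵘ.≃-sym (toℚᵘ-/ N D))
    (mkℚᵘ-mono N 1 D E (≤-trans NE≤D (≤-reflexive (sym (*-identityˡ (suc D))))))))

module _ {n k : ℕ} (G : Graph n) (v : Fin n) (c : Fin k) (xs : List (Fin n)) (path : Consec G (v ∷ xs)) where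

  private
    M = v ∷ xs
    Colourings = allVecs n k
    adm = admissible G v c

    onPath : Fin n → Bool
    onPath w = any (w ==_) M ∧ not (w == v)

    E : ℕ
    E = product (map (weight G k onPath) (allFin n))

    disagreeing : Vec (Fin k) n → Fin k → Bool
    disagreeing s q = not (q == c) ∧ all (inQ G (lookup s) v c q) M

  disagreeing⇒agrees : ∀ q s → T (adm s) → T (all (inQ G (lookup s) v c q) M) →
                       T (agrees onPath (alternate M c q) (allFin n) s)
  disagreeing⇒agrees q s adm-s M-disagrees = all⁻ _ {allFin n} (All.tabulate λ {w} _ → ⇒⁺ λ on-w →
    fromWitness (path-alternates G (lookup s) proper path sv≡c two-coloured w
                   (proj₁ (∧⁻ {any (w ==_) M} (Equivalence.from T-≡ on-w)))))
    where
    proper = properB⇒Proper G (lookup s) (proj₁ (∧⁻ adm-s))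
    sv≡c = toWitness (proj₂ (∧⁻ {properB G (lookup s)} adm-s))
    two-coloured : All (λ z → lookup s z ≡ c ⊎ lookup s z ≡ q) xs
    two-coloured = All.map (reachW-two-coloured G (lookup s) v c q n _)
      (all⁺ (inQ G (lookup s) v c q) xs (proj₂ (∧⁻ {inQ G (lookup s) v c q v} M-disagrees)))

  disagreement-bound : ∀ q → count (λ s → adm s ∧ disagreeing s q) Colourings * E
                               ≤ 𝟙 (not (q == c)) * count adm Colourings
  disagreement-bound q with q ≟ c
  ... | yes refl = *-monoˡ-≤ E (≤-trans (count-mono Colourings λ s → proj₂ ∘ ∧⁻ {adm s})
                                        (≤-reflexive (count-false Colourings)))
  ... | no _     = begin
    count (λ s → adm s ∧ all (inQ G (lookup s) v c q) M) Colourings * E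
      ≤⟨ *-monoˡ-≤ E (count-mono Colourings λ s d →
           let adm-s , M-d = ∧⁻ d in ∧⁺ (disagreeing⇒agrees q s adm-s M-d) adm-s) ⟩
    count (λ s → agrees onPath (alternate M c q) (allFin n) s ∧ adm s) Colourings * E
      ≤⟨ pinned-bound G v c onPath (λ w on-w → toWitnessFalse (proj₂ (∧⁻ {any (w ==_) M} on-w)))
                      (alternate M c q) (allFin n) (allFin⁺ n) ⟩
    count adm Colourings
      ≡⟨ sym (*-identityˡ _) ⟩
    1 * count adm Colourings ∎
    where open ≤-Reasoning

  disagreement-count : sum (map (λ s → count (disagreeing s) (allFin k)) (filterᵇ adm Colourings)) * E
                       ≤ count adm Colourings * (k ∸ 1)
  disagreement-count = begin
    sum (map (λ s → count (disagreeing s) (allFin k)) (filterᵇ adm Colourings)) * E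
      ≡⟨ cong (_* E) (sum-map _ (filterᵇ adm Colourings)) ⟩
    ∑[ s ∈ filterᵇ adm Colourings ] count (disagreeing s) (allFin k) * E
      ≡⟨ cong (_* E) (∑-filterᵇ adm Colourings _) ⟩
    ∑[ s ∈ Colourings ] (if adm s then count (disagreeing s) (allFin k) else 0) * E
      ≡⟨ cong (_* E) (∑-cong Colourings by-colour) ⟩
    ∑[ s ∈ Colourings ] ∑[ q ∈ allFin k ] 𝟙 (adm s ∧ disagreeing s q) * E
      ≡⟨ cong (_* E) (∑-comm Colourings (allFin k) _) ⟩
    ∑[ q ∈ allFin k ] ∑[ s ∈ Colourings ] 𝟙 (adm s ∧ disagreeing s q) * E
      ≡⟨ sym (∑-*ʳ E (allFin k) _) ⟩
    ∑[ q ∈ allFin k ] (∑[ s ∈ Colourings ] 𝟙 (adm s ∧ disagreeing s q) * E)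
      ≤⟨ ∑-mono (allFin k) (λ q → ≤-trans (≤-reflexive (cong (_* E) (sym (count-∑ _ Colourings))))
                                          (disagreement-bound q)) ⟩
    ∑[ q ∈ allFin k ] (𝟙 (not (q == c)) * count adm Colourings)
      ≡⟨ ∑-*ʳ (count adm Colourings) (allFin k) _ ⟩
    ∑[ q ∈ allFin k ] 𝟙 (not (q == c)) * count adm Colourings
      ≡⟨ cong (_* count adm Colourings) (trans (sym (count-∑ _ (allFin k))) (count-allFin-≢ c)) ⟩
    (k ∸ 1) * count adm Colourings
      ≡⟨ *-comm (k ∸ 1) _ ⟩
    count adm Colourings * (k ∸ 1) ∎
    where
    open ≤-Reasoning
    by-colour : ∀ s → (if adm s then count (disagreeing s) (allFin k) else 0)
                      ≡ ∑[ q ∈ allFin k ] 𝟙 (adm s ∧ disagreeing s q)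
    by-colour s with adm s
    ... | true  = count-∑ (disagreeing s) (allFin k)
    ... | false = sym (∑-zero (allFin k))

  PProb≃recip : toℚᵘ (PProb G v k M) ℚᵘ.≃ recip E
  PProb≃recip = toℚᵘ-product _ (weight G k onPath) (1≤weight G k onPath) factor (allFin n)
    where
    factor : ∀ w → toℚᵘ (if any (w ==_) M then pDis G v k w else 1ℚ) ℚᵘ.≃ recip (weight G k onPath w)
    factor w with any (w ==_) M
    ... | false = *≡* refl
    ... | true with w == v
    ... | true  = *≡* refl
    ... | false with k ∸ deg G w
    ... | zero  = *≡* refl
    ... | suc m = toℚᵘ-/ 1 m

lemma6 : ∀ {n} (G : Graph n) (v : Fin n) (k : ℕ) (c : Fin k) →
         Σ (Fin n → Fin k) (λ σ → Proper G σ × σ v ≡ c) →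
         (xs : List (Fin n)) → IsPath G (v ∷ xs) →
         LProb G v k c (v ∷ xs) ℚ.≤ PProb G v k (v ∷ xs)
lemma6 G v k c _ xs (path , _) =
  ratio-≤-recip _ _ _ _ (1≤product _ (1≤weight G k _) (allFin _))
    (disagreement-count G v c xs path) (PProb≃recip G v c xs path)
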